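{- Let $G(A,B)$ be a matching-covered bipartite graph. Then $G(A,B)$ has an equivalent class if and only if $G(A,B)$ has a 2-edge-cut which separates $G(A,B)$ into two balanced components.
   Context: A graph is matching-covered if it is connected, has a perfect matching, and every edge lies in some perfect matching. Two edges of a matching-covered graph $G$ are equivalent if every perfect matching of $G$ either contains both of them or contains neither. An equivalent class of $G$ is a set $K\subseteq E(G)$ with at least two edges such that any two edges of $K$ are equivalent. A bipartite graph $H(A',B')$ is balanced if $|A'|=|B'|$. A 2-edge-cut separating $G$ into two components is a set $S$ of two edges such that $G\setminus S$ consists of exactly those two components. -}

module Defs where

open import Data.Nat using (ℕ; zero; suc; _+_)
open import Data.Fin using (Fin; zero; suc)
open import Data.Bool using (Bool; true; false)
open import Data.Sum using (_⊎_; inj₁; inj₂)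
open import Data.Product using (Σ; ∃; ∃-syntax; _×_; _,_)
open import Relation.Nullary using (¬_)
open import Relation.Binary.PropositionalEquality using (_≡_)

record BipGraph (a b : ℕ) : Set where
  field
    adj : Fin a → Fin b → Bool

open BipGraph public

Vtx : ℕ → ℕ → Set
Vtx a b = Fin a ⊎ Fin b

Edge : ℕ → ℕ → Set
Edge a b = Fin a × Fin b

_∈E_ : ∀ {a b} → Edge a b → BipGraph a b → Set
(i , j) ∈E G = adj G i j ≡ true

EdgeRel : ℕ → ℕ → Set₁
EdgeRel a b = Fin a → Fin b → Set

edgesOf : ∀ {a b} → BipGraph a b → EdgeRel a b
edgesOf G i j = adj G i j ≡ true

data Reach {a b : ℕ} (E' : EdgeRel a b) (X : Vtx a b → Bool)
           (u : Vtx a b) : Vtx a b → Set where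
  here   : X u ≡ true → Reach E' X u u
  stepAB : ∀ {i j} → Reach E' X u (inj₁ i) → E' i j → X (inj₂ j) ≡ true →
           Reach E' X u (inj₂ j)
  stepBA : ∀ {i j} → Reach E' X u (inj₂ j) → E' i j → X (inj₁ i) ≡ true →
           Reach E' X u (inj₁ i)

ConnectedOn : ∀ {a b} → EdgeRel a b → (Vtx a b → Bool) → Set
ConnectedOn E' X =
  (∃[ v ] X v ≡ true) ×
  (∀ u v → X u ≡ true → X v ≡ true → Reach E' X u v)

allV : ∀ {a b} → Vtx a b → Bool
allV _ = true

Connected : ∀ {a b} → BipGraph a b → Set
Connected G = ConnectedOn (edgesOf G) allV

record PerfectMatching {a b} (G : BipGraph a b) : Set where
  field
    M      : Fin a → Fin b → Bool
    sub    : ∀ i j → M i j ≡ true → adj G i j ≡ true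
    coverA : ∀ i → ∃[ j ] M i j ≡ true
    uniqA  : ∀ i j j' → M i j ≡ true → M i j' ≡ true → j ≡ j'
    coverB : ∀ j → ∃[ i ] M i j ≡ true
    uniqB  : ∀ j i i' → M i j ≡ true → M i' j ≡ true → i ≡ i'

open PerfectMatching public

_∈M_ : ∀ {a b} {G : BipGraph a b} → Edge a b → PerfectMatching G → Set
(i , j) ∈M P = M P i j ≡ true

MatchingCovered : ∀ {a b} → BipGraph a b → Set
MatchingCovered G =
  Connected G ×
  PerfectMatching G ×
  (∀ e → e ∈E G → Σ (PerfectMatching G) λ P → e ∈M P)

Equivalent : ∀ {a b} (G : BipGraph a b) → Edge a b → Edge a b → Set
Equivalent G e f = ∀ (P : PerfectMatching G) → (e ∈M P → f ∈M P) × (f ∈M P → e ∈M P)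

IsEquivalentClass : ∀ {a b} (G : BipGraph a b) → (Edge a b → Set) → Set
IsEquivalentClass G K =
  (∀ e → K e → e ∈E G) ×
  (∃[ e ] ∃[ f ] (K e × K f × ¬ (e ≡ f))) ×
  (∀ e f → K e → K f → Equivalent G e f)

HasEquivalentClass : ∀ {a b} → BipGraph a b → Set₁
HasEquivalentClass G = Σ (Edge _ _ → Set) λ K → IsEquivalentClass G K

countTrue : ∀ {n} → (Fin n → Bool) → ℕ
countTrue {zero}  p = 0
countTrue {suc n} p with p zero
... | true  = suc (countTrue (λ k → p (suc k)))
... | false = countTrue (λ k → p (suc k))

Balanced : ∀ {a b} → (Vtx a b → Bool) → Set
Balanced X = countTrue (λ i → X (inj₁ i)) ≡ countTrue (λ j → X (inj₂ j))

notB : Bool → Bool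
notB true  = false
notB false = true

removeEdges : ∀ {a b} → BipGraph a b → Edge a b → Edge a b → EdgeRel a b
removeEdges G e₁ e₂ i j = (adj G i j ≡ true) × ¬ ((i , j) ≡ e₁) × ¬ ((i , j) ≡ e₂)

TwoEdgeCutBalanced : ∀ {a b} → BipGraph a b → Set
TwoEdgeCutBalanced {a} {b} G =
  ∃[ e₁ ] ∃[ e₂ ] Σ (Vtx a b → Bool) λ X →
    (e₁ ∈E G) × (e₂ ∈E G) × ¬ (e₁ ≡ e₂) ×
    -- the two components of G \ S are X and its complement:
    ConnectedOn (removeEdges G e₁ e₂) X ×
    ConnectedOn (removeEdges G e₁ e₂) (λ v → notB (X v)) ×
    (∀ i j → removeEdges G e₁ e₂ i j → X (inj₁ i) ≡ X (inj₂ j)) ×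
    Balanced X × Balanced (λ v → notB (X v))

-- (⇐) If only e₁ and e₂ join the balanced side X to its complement, a perfect
-- matching containing exactly one of them would pair the A-vertices of X with
-- all but one, or all plus one, of its B-vertices, contradicting balance.
--
-- (⇒) Let e = a₁b₁ and f = a₂b₂ be equivalent and both lie in the perfect
-- matching P. Let X be the set of vertices reachable from b₁ along P-alternating
-- arcs: non-matching edges from B to A and matching edges from A to B, the latter
-- not leaving a₁ or a₂. A path from b₁ to a₁ would close an alternating cycle
-- through e avoiding f, and switching P along it gives a perfect matching with f
-- but not e; so a₁ ∉ X, and similarly b₂ ∉ X. Comparing the sizes of X ∩ A and
-- X ∩ B under P and under other perfect matchings shows that a₂ ∈ X, that X is
-- balanced, and that no edge other than e and f leaves X. The same construction
-- in the transposed graph, started at a₁, produces the complement of X, which is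
-- therefore connected as well.
module Submission where

open import Defs
open import Data.Bool using (Bool; true; false; _∨_; _∧_; not)
open import Data.Bool.Properties using (¬-not) renaming (_≟_ to _≟B_)
open import Data.Empty using (⊥; ⊥-elim)
open import Data.Fin using (Fin; zero; suc)
open import Data.Fin.Properties using (suc-injective; any?) renaming (_≟_ to _≟F_)
open import Data.Nat using (ℕ; zero; suc; _≤_; _<_; z≤n; s≤s; _+_)
open import Data.Nat.Properties
  using ( _≟_; ≤-refl; ≤-reflexive; ≤-trans; ≤-antisym; <⇒≤; <⇒≱; <-irrefl; <-cmp; n≤1+n; m≤n⇒m≤1+n
        ; m≤n⇒m<n∨m≡n; 1+n≢n; m≤m+n; m≤n+m; +-mono-≤; +-suc; anyUpTo? )
import Data.Nat.Properties as ℕ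
open import Data.Product using (Σ; ∃; ∃-syntax; _×_; _,_; proj₁; proj₂) renaming (swap to ×-swap)
open import Data.Product.Properties using () renaming (≡-dec to ×-≡-dec)
open import Data.Sum using (_⊎_; inj₁; inj₂; [_,_]; [_,_]′; swap)
open import Data.Sum.Properties using (inj₁-injective; inj₂-injective; swap-involutive) renaming (≡-dec to ⊎-≡-dec)
open import Data.Unit using (⊤; tt)
open import Function using (_∘_; _∋_; id; flip)
open import Function.Definitions using (Injective)
open import Relation.Binary.Definitions using (DecidableEquality; tri<; tri≈; tri>)
open import Relation.Binary.PropositionalEquality hiding ([_])
open import Relation.Nullary using (¬_; Dec; yes; no; does; ¬?; _×-dec_; _⊎-dec_)
open import Relation.Nullary.Decidable using (decidable-stable; map′; dec-true; dec-false)

≡true⇒≢false : ∀ {x} → x ≡ true → x ≡ false → ⊥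
≡true⇒≢false refl ()

bool-cases : ∀ {ℓ} {A : Set ℓ} (x : Bool) → (x ≡ true → A) → (x ≡ false → A) → A
bool-cases true  t f = t refl
bool-cases false t f = f refl

∨-true⇒⊎ : ∀ {x y} → x ∨ y ≡ true → x ≡ true ⊎ y ≡ true
∨-true⇒⊎ {true}  _ = inj₁ refl
∨-true⇒⊎ {false} e = inj₂ e

∨-trueˡ : ∀ {x y} → x ≡ true → x ∨ y ≡ true
∨-trueˡ refl = refl

∨-trueʳ : ∀ {x y} → y ≡ true → x ∨ y ≡ true
∨-trueʳ {true}  _ = refl
∨-trueʳ {false} e = e

∧-true⇒× : ∀ {x y} → x ∧ y ≡ true → x ≡ true × y ≡ true
∧-true⇒× {true} {true} _ = refl , refl

∧-true : ∀ {x y} → x ≡ true → y ≡ true → x ∧ y ≡ true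
∧-true refl refl = refl

not≡true⇒≡false : ∀ {x} → not x ≡ true → x ≡ false
not≡true⇒≡false {false} _ = refl

≡false⇒not≡true : ∀ {x} → x ≡ false → not x ≡ true
≡false⇒not≡true refl = refl

notB≡true⇒≡false : ∀ {x} → notB x ≡ true → x ≡ false
notB≡true⇒≡false {false} _ = refl

-- Counting

module _ {n : ℕ} where

  countTrue-zero-true : (p : Fin (suc n) → Bool) → p zero ≡ true →
    countTrue p ≡ suc (countTrue (p ∘ suc))
  countTrue-zero-true p eq with p zero
  countTrue-zero-true p refl | true = refl

  countTrue-zero-false : (p : Fin (suc n) → Bool) → p zero ≡ false →
    countTrue p ≡ countTrue (p ∘ suc)
  countTrue-zero-false p eq with p zero
  countTrue-zero-false p refl | false = refl

countTrue-cong : ∀ {n} {p q : Fin n → Bool} → p ≗ q → countTrue p ≡ countTrue q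
countTrue-cong {zero}          p≗q = refl
countTrue-cong {suc n} {p} {q} p≗q with p zero | q zero | p≗q zero
... | true  | true  | _ = cong suc (countTrue-cong (p≗q ∘ suc))
... | false | false | _ = countTrue-cong (p≗q ∘ suc)

remove : ∀ {n} → (Fin n → Bool) → Fin n → Fin n → Bool
remove p k i with i ≟F k
... | yes _ = false
... | no  _ = p i

remove-self : ∀ {n} (p : Fin n → Bool) k → remove p k k ≡ false
remove-self p k with k ≟F k
... | yes _  = refl
... | no k≢k = ⊥-elim (k≢k refl)

remove-≢ : ∀ {n} (p : Fin n → Bool) {k i} → i ≢ k → remove p k i ≡ p i
remove-≢ p {k} {i} i≢k with i ≟F k
... | yes i≡k = ⊥-elim (i≢k i≡k)
... | no  _   = refl

remove-⊆ : ∀ {n} (p : Fin n → Bool) k {i} → remove p k i ≡ true → p i ≡ true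
remove-⊆ p k {i} h with i ≟F k
... | no _ = h

remove-true⇒≢ : ∀ {n} (p : Fin n → Bool) k {i} → remove p k i ≡ true → i ≢ k
remove-true⇒≢ p k h refl = ≡true⇒≢false h (remove-self p k)

remove-suc : ∀ {n} (p : Fin (suc n) → Bool) k → remove (p ∘ suc) k ≗ remove p (suc k) ∘ suc
remove-suc p k i with i ≟F k | suc i ≟F suc k
... | yes _   | yes _   = refl
... | no  _   | no  _   = refl
... | yes i≡k | no  i≢k = ⊥-elim (i≢k (cong suc i≡k))
... | no  i≢k | yes i≡k = ⊥-elim (i≢k (suc-injective i≡k))

countTrue-remove : ∀ {n} (p : Fin n → Bool) k → p k ≡ true →
  countTrue p ≡ suc (countTrue (remove p k))
countTrue-remove p zero pk = begin
  countTrue p                            ≡⟨ countTrue-zero-true p pk ⟩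
  suc (countTrue (remove p zero ∘ suc))  ≡⟨ cong suc (countTrue-zero-false (remove p zero) refl) ⟨
  suc (countTrue (remove p zero))        ∎
  where open ≡-Reasoning
countTrue-remove p (suc k) pk = bool-cases (p zero) head-true head-false
  where
  open ≡-Reasoning
  head-true : p zero ≡ true → countTrue p ≡ suc (countTrue (remove p (suc k)))
  head-true p₀ = begin
    countTrue p                                 ≡⟨ countTrue-zero-true p p₀ ⟩
    suc (countTrue (p ∘ suc))                   ≡⟨ cong suc (countTrue-remove (p ∘ suc) k pk) ⟩
    suc (suc (countTrue (remove (p ∘ suc) k)))
      ≡⟨ cong (λ c → suc (suc c)) (countTrue-cong {p = remove (p ∘ suc) k} (remove-suc p k)) ⟩
    suc (suc (countTrue (remove p (suc k) ∘ suc))) ≡⟨ cong suc (countTrue-zero-true (remove p (suc k)) p₀) ⟨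
    suc (countTrue (remove p (suc k)))          ∎
  head-false : p zero ≡ false → countTrue p ≡ suc (countTrue (remove p (suc k)))
  head-false p₀ = begin
    countTrue p                                 ≡⟨ countTrue-zero-false p p₀ ⟩
    countTrue (p ∘ suc)                         ≡⟨ countTrue-remove (p ∘ suc) k pk ⟩
    suc (countTrue (remove (p ∘ suc) k))
      ≡⟨ cong suc (countTrue-cong {p = remove (p ∘ suc) k} (remove-suc p k)) ⟩
    suc (countTrue (remove p (suc k) ∘ suc))    ≡⟨ cong suc (countTrue-zero-false (remove p (suc k)) p₀) ⟨
    suc (countTrue (remove p (suc k)))          ∎

countTrue-positive : ∀ {n} (p : Fin n → Bool) k → p k ≡ true → 0 < countTrue p
countTrue-positive p k pk = subst (0 <_) (sym (countTrue-remove p k pk)) (s≤s z≤n)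

countTrue≤n : ∀ {n} (p : Fin n → Bool) → countTrue p ≤ n
countTrue≤n {zero}  p = z≤n
countTrue≤n {suc n} p = bool-cases (p zero)
  (λ p₀ → subst (_≤ suc n) (sym (countTrue-zero-true p p₀)) (s≤s (countTrue≤n (p ∘ suc))))
  (λ p₀ → subst (_≤ suc n) (sym (countTrue-zero-false p p₀)) (≤-trans (countTrue≤n (p ∘ suc)) (n≤1+n n)))

countTrue-injection-≤ : ∀ {n m} (p : Fin n → Bool) (q : Fin m → Bool) (f : Fin n → Fin m) →
  Injective _≡_ _≡_ f → (∀ i → p i ≡ true → q (f i) ≡ true) → countTrue p ≤ countTrue q
countTrue-injection-≤ {zero}  p q f f-inj p⇒q = z≤n
countTrue-injection-≤ {suc n} p q f f-inj p⇒q = bool-cases (p zero) head-true head-false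
  where
  head-false : p zero ≡ false → countTrue p ≤ countTrue q
  head-false p₀ = subst (_≤ countTrue q) (sym (countTrue-zero-false p p₀))
    (countTrue-injection-≤ (p ∘ suc) q (f ∘ suc) (suc-injective ∘ f-inj) (p⇒q ∘ suc))
  0≢1+n : ∀ {i : Fin n} → zero ≢ suc i
  0≢1+n ()
  head-true : p zero ≡ true → countTrue p ≤ countTrue q
  head-true p₀ = subst₂ _≤_ (sym (countTrue-zero-true p p₀)) (sym (countTrue-remove q (f zero) (p⇒q zero p₀)))
    (s≤s (countTrue-injection-≤ (p ∘ suc) (remove q (f zero)) (f ∘ suc) (suc-injective ∘ f-inj)
      (λ i pi → trans (remove-≢ q (λ eq → 0≢1+n (f-inj (sym eq)))) (p⇒q (suc i) pi))))

countTrue-injection-< : ∀ {n m} (p : Fin n → Bool) (q : Fin m → Bool) (f : Fin n → Fin m) →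
  Injective _≡_ _≡_ f → (∀ i → p i ≡ true → q (f i) ≡ true) →
  ∀ k → q k ≡ true → (∀ i → p i ≡ true → f i ≢ k) → countTrue p < countTrue q
countTrue-injection-< p q f f-inj p⇒q k qk missed =
  subst (suc (countTrue p) ≤_) (sym (countTrue-remove q k qk))
    (s≤s (countTrue-injection-≤ p (remove q k) f f-inj
      (λ i pi → trans (remove-≢ q (missed i pi)) (p⇒q i pi))))

countTrue-mono : ∀ {n} (p q : Fin n → Bool) → (∀ i → p i ≡ true → q i ≡ true) → countTrue p ≤ countTrue q
countTrue-mono p q = countTrue-injection-≤ p q id id

countTrue-bijection : ∀ {n m} (p : Fin n → Bool) (q : Fin m → Bool) (σ : Fin n → Fin m) (τ : Fin m → Fin n) →
  (∀ i → τ (σ i) ≡ i) → (∀ j → σ (τ j) ≡ j) → p ≗ q ∘ σ → countTrue p ≡ countTrue q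
countTrue-bijection p q σ τ τσ στ p≗qσ = ≤-antisym
  (countTrue-injection-≤ p q σ (inverseˡ⇒injective σ τ τσ) (λ i pi → trans (sym (p≗qσ i)) pi))
  (countTrue-injection-≤ q p τ (inverseˡ⇒injective τ σ στ)
    (λ j qj → trans (p≗qσ (τ j)) (trans (cong q (στ j)) qj)))
  where
  inverseˡ⇒injective : ∀ {A B : Set} (f : A → B) (g : B → A) → (∀ x → g (f x) ≡ x) → Injective _≡_ _≡_ f
  inverseˡ⇒injective f g gf {x} {y} eq = trans (sym (gf x)) (trans (cong g eq) (gf y))

-- Perfect matchings and balanced sets

module Partner {a b} {G : BipGraph a b} (P : PerfectMatching G) where

  mate : Fin a → Fin b
  mate i = proj₁ (coverA P i)

  mate⁻¹ : Fin b → Fin a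
  mate⁻¹ j = proj₁ (coverB P j)

  mate-∈ : ∀ i → M P i (mate i) ≡ true
  mate-∈ i = proj₂ (coverA P i)

  mate⁻¹-∈ : ∀ j → M P (mate⁻¹ j) j ≡ true
  mate⁻¹-∈ j = proj₂ (coverB P j)

  ∈⇒mate : ∀ {i j} → M P i j ≡ true → mate i ≡ j
  ∈⇒mate {i} = uniqA P i _ _ (mate-∈ i)

  ∈⇒mate⁻¹ : ∀ {i j} → M P i j ≡ true → mate⁻¹ j ≡ i
  ∈⇒mate⁻¹ {j = j} = uniqB P j _ _ (mate⁻¹-∈ j)

  mate⁻¹-mate : ∀ i → mate⁻¹ (mate i) ≡ i
  mate⁻¹-mate i = ∈⇒mate⁻¹ (mate-∈ i)

  mate-mate⁻¹ : ∀ j → mate (mate⁻¹ j) ≡ j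
  mate-mate⁻¹ j = ∈⇒mate (mate⁻¹-∈ j)

  mate-injective : Injective _≡_ _≡_ mate
  mate-injective {i} {i'} eq = trans (sym (mate⁻¹-mate i)) (trans (cong mate⁻¹ eq) (mate⁻¹-mate i'))

  mate⁻¹-injective : Injective _≡_ _≡_ mate⁻¹
  mate⁻¹-injective {j} {j'} eq = trans (sym (mate-mate⁻¹ j)) (trans (cong mate eq) (mate-mate⁻¹ j'))

Crosses : ∀ {a b} → (Vtx a b → Bool) → Edge a b → Set
Crosses X (i , j) = X (inj₁ i) ≢ X (inj₂ j)

module _ {a b} {G : BipGraph a b} (Q : PerfectMatching G) (Y : Vtx a b → Bool) where

  open Partner Q

  balanced-crossed-once-absurd : Balanced Y → ∀ i₀ → Crosses Y (i₀ , mate i₀) →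
    (∀ i → i ≢ i₀ → Y (inj₁ i) ≡ Y (inj₂ (mate i))) → ⊥
  balanced-crossed-once-absurd bal i₀ crosses others =
    bool-cases (Y (inj₁ i₀)) in-Y out-Y
    where
    YA = Y ∘ inj₁
    YB = Y ∘ inj₂
    in-Y : YA i₀ ≡ true → ⊥
    in-Y yi₀ = 1+n≢n (begin
      suc (countTrue YB)               ≡⟨ cong suc (countTrue-bijection (remove YA i₀) YB mate mate⁻¹
                                            mate⁻¹-mate mate-mate⁻¹ agree) ⟨
      suc (countTrue (remove YA i₀))   ≡⟨ countTrue-remove YA i₀ yi₀ ⟨
      countTrue YA                     ≡⟨ bal ⟩
      countTrue YB                     ∎)
      where
      open ≡-Reasoning
      agree : remove YA i₀ ≗ YB ∘ mate
      agree i with i ≟F i₀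
      ... | yes refl = sym (trans (¬-not (crosses ∘ sym)) (cong not yi₀))
      ... | no  i≢i₀ = others i i≢i₀
    out-Y : YA i₀ ≡ false → ⊥
    out-Y yi₀ = 1+n≢n (begin
      suc (countTrue YA)                    ≡⟨ cong suc (countTrue-bijection YA (remove YB (mate i₀)) mate mate⁻¹
                                                 mate⁻¹-mate mate-mate⁻¹ agree) ⟩
      suc (countTrue (remove YB (mate i₀))) ≡⟨ countTrue-remove YB (mate i₀) ymi₀ ⟨
      countTrue YB                          ≡⟨ bal ⟨
      countTrue YA                          ∎)
      where
      open ≡-Reasoning
      ymi₀ : YB (mate i₀) ≡ true
      ymi₀ = trans (¬-not (crosses ∘ sym)) (cong not yi₀)
      agree : YA ≗ remove YB (mate i₀) ∘ mate
      agree i with i ≟F i₀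
      ... | yes refl = trans yi₀ (sym (remove-self YB (mate i₀)))
      ... | no  i≢i₀ = trans (others i i≢i₀) (sym (remove-≢ YB (i≢i₀ ∘ mate-injective)))

  balanced-if-crossed-oppositely : ∀ i₁ i₂ → i₁ ≢ i₂ →
    Y (inj₁ i₁) ≡ false → Y (inj₂ (mate i₁)) ≡ true →
    Y (inj₁ i₂) ≡ true → Y (inj₂ (mate i₂)) ≡ false →
    (∀ i → i ≢ i₁ → i ≢ i₂ → Y (inj₁ i) ≡ Y (inj₂ (mate i))) → Balanced Y
  balanced-if-crossed-oppositely i₁ i₂ i₁≢i₂ yi₁ ymi₁ yi₂ ymi₂ others = begin
    countTrue YA                           ≡⟨ countTrue-remove YA i₂ yi₂ ⟩
    suc (countTrue (remove YA i₂))         ≡⟨ cong suc (countTrue-bijection (remove YA i₂) (remove YB (mate i₁))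
                                                mate mate⁻¹ mate⁻¹-mate mate-mate⁻¹ agree) ⟩
    suc (countTrue (remove YB (mate i₁)))  ≡⟨ countTrue-remove YB (mate i₁) ymi₁ ⟨
    countTrue YB                           ∎
    where
    open ≡-Reasoning
    YA = Y ∘ inj₁
    YB = Y ∘ inj₂
    agree : remove YA i₂ ≗ remove YB (mate i₁) ∘ mate
    agree i with i ≟F i₂ | i ≟F i₁
    ... | yes refl | _        = sym (trans (remove-≢ YB (i₁≢i₂ ∘ mate-injective ∘ sym)) ymi₂)
    ... | no  _    | yes refl = trans yi₁ (sym (remove-self YB (mate i₁)))
    ... | no  i≢i₂ | no  i≢i₁ = trans (others i i≢i₁ i≢i₂) (sym (remove-≢ YB (i≢i₁ ∘ mate-injective)))

-- Reachability

module _ {a b} {E : EdgeRel a b} {X : Vtx a b → Bool} where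

  reach-end : ∀ {u v} → Reach E X u v → X v ≡ true
  reach-end (here x)       = x
  reach-end (stepAB _ _ x) = x
  reach-end (stepBA _ _ x) = x

  reach-trans : ∀ {u v w} → Reach E X u v → Reach E X v w → Reach E X u w
  reach-trans r (here _)        = r
  reach-trans r (stepAB r' e x) = stepAB (reach-trans r r') e x
  reach-trans r (stepBA r' e x) = stepBA (reach-trans r r') e x

  reach-sym : ∀ {u v} → Reach E X u v → Reach E X v u
  reach-sym (here x)       = here x
  reach-sym (stepAB r e x) = reach-trans (stepBA (here x) e (reach-end r)) (reach-sym r)
  reach-sym (stepBA r e x) = reach-trans (stepAB (here x) e (reach-end r)) (reach-sym r)

  reach-crossing : (S : Vtx a b → Bool) → ∀ {u v} → Reach E X u v → S u ≡ true → S v ≡ false →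
    ∃[ i ] ∃[ j ] (E i j × Crosses S (i , j))
  reach-crossing S (here _) su sv = ⊥-elim (≡true⇒≢false su sv)
  reach-crossing S (stepAB {i} {j} r e _) su sv with S (inj₁ i) in si
  ... | true  = i , j , e , λ eq → ≡true⇒≢false si (trans eq sv)
  ... | false = reach-crossing S r su si
  reach-crossing S (stepBA {i} {j} r e _) su sv with S (inj₂ j) in sj
  ... | true  = i , j , e , λ eq → ≡true⇒≢false sj (trans (sym eq) sv)
  ... | false = reach-crossing S r su sj

reach-map : ∀ {a b} {E E' : EdgeRel a b} {X X' : Vtx a b → Bool} {u v} →
  (∀ i j → E i j → E' i j) → (∀ w → X w ≡ true → X' w ≡ true) → Reach E X u v → Reach E' X' u v
reach-map f g (here x)       = here (g _ x)
reach-map f g (stepAB r e x) = stepAB (reach-map f g r) (f _ _ e) (g _ x)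
reach-map f g (stepBA r e x) = stepBA (reach-map f g r) (f _ _ e) (g _ x)

-- Balanced sets cut out by two edges

_≟E_ : ∀ {a b} → (e f : Edge a b) → Dec (e ≡ f)
_≟E_ = ×-≡-dec _≟F_ _≟F_

EdgePair : ∀ {a b} → Edge a b → Edge a b → Edge a b → Set
EdgePair e₁ e₂ e = e ≡ e₁ ⊎ e ≡ e₂

equivalent-pair⇒equivalentClass : ∀ {a b} {G : BipGraph a b} {e₁ e₂} →
  e₁ ∈E G → e₂ ∈E G → e₁ ≢ e₂ → Equivalent G e₁ e₂ → HasEquivalentClass G
equivalent-pair⇒equivalentClass {G = G} {e₁} {e₂} e₁∈G e₂∈G e₁≢e₂ e₁~e₂ =
  EdgePair e₁ e₂ , ⊆G , (e₁ , e₂ , inj₁ refl , inj₂ refl , e₁≢e₂) , equiv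
  where
  ⊆G : ∀ e → EdgePair e₁ e₂ e → e ∈E G
  ⊆G _ (inj₁ refl) = e₁∈G
  ⊆G _ (inj₂ refl) = e₂∈G
  equiv : ∀ e f → EdgePair e₁ e₂ e → EdgePair e₁ e₂ f → Equivalent G e f
  equiv _ _ (inj₁ refl) (inj₁ refl) Q = id , id
  equiv _ _ (inj₂ refl) (inj₂ refl) Q = id , id
  equiv _ _ (inj₁ refl) (inj₂ refl) Q = e₁~e₂ Q
  equiv _ _ (inj₂ refl) (inj₁ refl) Q = ×-swap (e₁~e₂ Q)

crosses? : ∀ {a b} (X : Vtx a b → Bool) e → Dec (Crosses X e)
crosses? X (i , j) = ¬? (X (inj₁ i) ≟B X (inj₂ j))

module CutByTwoEdges {a b} (G : BipGraph a b) (X : Vtx a b → Bool) (balanced : Balanced X) {g h : Edge a b}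
         (only : ∀ i j → adj G i j ≡ true → Crosses X (i , j) → (i , j) ≡ g ⊎ (i , j) ≡ h) where

  lone-crossing-absurd : (Q : PerfectMatching G) → g ∈M Q → Crosses X g → ¬ (h ∈M Q × Crosses X h) → ⊥
  lone-crossing-absurd Q g∈Q g-crosses ¬h = balanced-crossed-once-absurd Q X balanced (proj₁ g)
    (subst (λ j → Crosses X (proj₁ g , j)) (sym (∈⇒mate g∈Q)) g-crosses) flat
    where
    open Partner Q
    flat : ∀ i → i ≢ proj₁ g → X (inj₁ i) ≡ X (inj₂ (mate i))
    flat i i≢g₁ with X (inj₁ i) ≟B X (inj₂ (mate i))
    ... | yes eq = eq
    ... | no crosses with only i (mate i) (sub Q i (mate i) (mate-∈ i)) crosses
    ... | inj₁ refl = ⊥-elim (i≢g₁ refl)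
    ... | inj₂ refl = ⊥-elim (¬h (mate-∈ i , crosses))

  crossing-partner : (Q : PerfectMatching G) → g ∈M Q → Crosses X g → h ∈M Q × Crosses X h
  crossing-partner Q g∈Q g-crosses = decidable-stable
    ((M Q (proj₁ h) (proj₂ h) ≟B true) ×-dec crosses? X h) (lone-crossing-absurd Q g∈Q g-crosses)

twoEdgeCut⇒equivalentClass : ∀ {a b} (G : BipGraph a b) → MatchingCovered G →
  TwoEdgeCutBalanced G → HasEquivalentClass G
twoEdgeCut⇒equivalentClass G (connected , _ , covered)
  (e₁ , e₂ , X , e₁∈G , e₂∈G , e₁≢e₂ , ((v , Xv) , _) , ((w , Xᶜw) , _) , flat , balanced , _) =
  equivalent-pair⇒equivalentClass e₁∈G e₂∈G e₁≢e₂
    (λ Q → (λ e₁∈Q → proj₁ (C₁₂.crossing-partner Q e₁∈Q (proj₁ both-cross))) ,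
           (λ e₂∈Q → proj₁ (C₂₁.crossing-partner Q e₂∈Q (proj₂ both-cross))))
  where
  only₁₂ : ∀ i j → adj G i j ≡ true → Crosses X (i , j) → (i , j) ≡ e₁ ⊎ (i , j) ≡ e₂
  only₁₂ i j ij∈G crosses with (i , j) ≟E e₁ | (i , j) ≟E e₂
  ... | yes eq  | _       = inj₁ eq
  ... | no _    | yes eq  = inj₂ eq
  ... | no ≢e₁  | no ≢e₂  = ⊥-elim (crosses (flat i j (ij∈G , ≢e₁ , ≢e₂)))
  only₂₁ : ∀ i j → adj G i j ≡ true → Crosses X (i , j) → (i , j) ≡ e₂ ⊎ (i , j) ≡ e₁
  only₂₁ i j ij∈G = swap ∘ only₁₂ i j ij∈G
  module C₁₂ = CutByTwoEdges G X balanced only₁₂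
  module C₂₁ = CutByTwoEdges G X balanced only₂₁
  both-cross : Crosses X e₁ × Crosses X e₂
  both-cross with reach-crossing X (proj₂ connected v w refl refl) Xv (notB≡true⇒≡false Xᶜw)
  ... | i , j , ij∈G , crosses with only₁₂ i j ij∈G crosses
  ... | inj₁ refl = crosses , proj₂ (C₁₂.crossing-partner Q₁ e₁∈Q₁ crosses)
    where open Σ (covered e₁ e₁∈G) renaming (proj₁ to Q₁; proj₂ to e₁∈Q₁)
  ... | inj₂ refl = proj₂ (C₂₁.crossing-partner Q₂ e₂∈Q₂ crosses) , crosses
    where open Σ (covered e₂ e₂∈G) renaming (proj₁ to Q₂; proj₂ to e₂∈Q₂)

-- Closure in a finite digraph

does⇒ : ∀ {ℓ} {A : Set ℓ} (d : Dec A) → does d ≡ true → A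
does⇒ (yes a) _ = a

_≟V_ : ∀ {a b} → DecidableEquality (Vtx a b)
_≟V_ = ⊎-≡-dec _≟F_ _≟F_

∃V? : ∀ {a b} (p : Vtx a b → Bool) → Dec (∃[ v ] p v ≡ true)
∃V? p = map′ [ (λ (i , pi) → inj₁ i , pi) , (λ (j , pj) → inj₂ j , pj) ]′ to
  (any? (λ i → p (inj₁ i) ≟B true) ⊎-dec any? (λ j → p (inj₂ j) ≟B true))
  where
  to : ∃[ v ] p v ≡ true → (∃[ i ] p (inj₁ i) ≡ true) ⊎ (∃[ j ] p (inj₂ j) ≡ true)
  to (inj₁ i , pv) = inj₁ (i , pv)
  to (inj₂ j , pv) = inj₂ (j , pv)

inj₁≢inj₂ : ∀ {a b} {i : Fin a} {j : Fin b} → (Vtx a b ∋ inj₁ i) ≢ inj₂ j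
inj₁≢inj₂ ()

record Path {a b} (Ed : Vtx a b → Vtx a b → Bool) (s t : Vtx a b) : Set where
  field
    length : ℕ
    vertex : ℕ → Vtx a b
    starts : vertex 0 ≡ s
    ends   : vertex length ≡ t
    steps  : ∀ m → m < length → Ed (vertex m) (vertex (suc m)) ≡ true
    simple : ∀ m m' → m ≤ length → m' ≤ length → vertex m ≡ vertex m' → m ≡ m'

module Closure {a b} (Ed : Vtx a b → Vtx a b → Bool) (s : Vtx a b) where

  level : ℕ → Vtx a b → Bool
  level zero    v = does (v ≟V s)
  level (suc k) v = level k v ∨ does (∃V? (λ u → level k u ∧ Ed u v))

  level-suc : ∀ k {v} → level k v ≡ true → level (suc k) v ≡ true
  level-suc k = ∨-trueˡ

  level-mono : ∀ {k k'} → k ≤ k' → ∀ {v} → level k v ≡ true → level k' v ≡ true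
  level-mono k≤k' lv with m≤n⇒m<n∨m≡n k≤k'
  ... | inj₂ refl                 = lv
  ... | inj₁ (s≤s {n = k''} k≤k'') = level-suc k'' (level-mono k≤k'' lv)

  level-step : ∀ k {u v} → level k u ≡ true → Ed u v ≡ true → level (suc k) v ≡ true
  level-step k {u} {v} lu e = ∨-trueʳ {level k v} (dec-true (∃V? (λ w → level k w ∧ Ed w v)) (u , ∧-true lu e))

  level-suc-inv : ∀ k {v} → level (suc k) v ≡ true →
    level k v ≡ true ⊎ ∃[ u ] (level k u ≡ true × Ed u v ≡ true)
  level-suc-inv k {v} lv with ∨-true⇒⊎ {level k v} lv
  ... | inj₁ lkv = inj₁ lkv
  ... | inj₂ new with does⇒ (∃V? (λ w → level k w ∧ Ed w v)) new
  ... | u , lu∧e = inj₂ (u , ∧-true⇒× lu∧e)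

  level-zero-inv : ∀ {v} → level 0 v ≡ true → v ≡ s
  level-zero-inv {v} = does⇒ (v ≟V s)

  level-zero-source : level 0 s ≡ true
  level-zero-source = dec-true (s ≟V s) refl

  Saturated : ℕ → Set
  Saturated k = ∀ v → level (suc k) v ≡ true → level k v ≡ true

  saturated-suc : ∀ {k} → Saturated k → Saturated (suc k)
  saturated-suc {k} sat v lv with level-suc-inv (suc k) lv
  ... | inj₁ lkv          = level-suc k (sat v lkv)
  ... | inj₂ (u , lu , e) = level-step k (sat u lu) e

  saturated-mono : ∀ {k k'} → k ≤ k' → Saturated k → Saturated k'
  saturated-mono k≤k' sat with m≤n⇒m<n∨m≡n k≤k'
  ... | inj₂ refl        = sat
  ... | inj₁ (s≤s {n = k''} k≤k'') = saturated-suc {k''} (saturated-mono k≤k'' sat)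

  saturated-or-new : ∀ k → Saturated k ⊎ ∃[ v ] (level (suc k) v ≡ true × level k v ≡ false)
  saturated-or-new k with ∃V? (λ v → level (suc k) v ∧ not (level k v))
  ... | yes (v , new) = inj₂ (v , proj₁ (∧-true⇒× new) , not≡true⇒≡false (proj₂ (∧-true⇒× new)))
  ... | no  none      = inj₁ λ v lv → bool-cases (level k v) (λ lkv → lkv)
                          (λ lkv → ⊥-elim (none (v , ∧-true lv (≡false⇒not≡true lkv))))

  size : ℕ → ℕ
  size k = countTrue (level k ∘ inj₁) + countTrue (level k ∘ inj₂)

  size≤order : ∀ k → size k ≤ a + b
  size≤order k = +-mono-≤ (countTrue≤n (level k ∘ inj₁)) (countTrue≤n (level k ∘ inj₂))

  size-positive : ∀ {k} v → level k v ≡ true → 0 < size k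
  size-positive {k} (inj₁ i) lv = ≤-trans (countTrue-positive (level k ∘ inj₁) i lv) (m≤m+n _ _)
  size-positive {k} (inj₂ j) lv = ≤-trans (countTrue-positive (level k ∘ inj₂) j lv) (m≤n+m _ _)

  size-grows : ∀ k v → level (suc k) v ≡ true → level k v ≡ false → size k < size (suc k)
  size-grows k (inj₁ i) new old = +-mono-≤
    (countTrue-injection-< (level k ∘ inj₁) (level (suc k) ∘ inj₁) (λ x → x) (λ eq → eq)
      (λ _ → level-suc k) i new (λ _ lx x≡i → ≡true⇒≢false (subst (λ y → level k (inj₁ y) ≡ true) x≡i lx) old))
    (countTrue-mono (level k ∘ inj₂) (level (suc k) ∘ inj₂) (λ _ → level-suc k))
  size-grows k (inj₂ j) new old = subst (_≤ size (suc k)) (+-suc _ _) (+-mono-≤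
    (countTrue-mono (level k ∘ inj₁) (level (suc k) ∘ inj₁) (λ _ → level-suc k))
    (countTrue-injection-< (level k ∘ inj₂) (level (suc k) ∘ inj₂) (λ x → x) (λ eq → eq)
      (λ _ → level-suc k) j new (λ _ lx x≡j → ≡true⇒≢false (subst (λ y → level k (inj₂ y) ≡ true) x≡j lx) old)))

  saturated-or-large : ∀ k → (∃[ j ] (j ≤ k × Saturated j)) ⊎ k < size k
  saturated-or-large zero = inj₂ (size-positive {0} s level-zero-source)
  saturated-or-large (suc k) with saturated-or-large k
  ... | inj₁ (j , j≤k , sat) = inj₁ (j , m≤n⇒m≤1+n j≤k , sat)
  ... | inj₂ k<size with saturated-or-new k
  ... | inj₁ sat             = inj₁ (k , n≤1+n k , sat)
  ... | inj₂ (v , new , old) = inj₂ (≤-trans (s≤s k<size) (size-grows k v new old))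

  saturated-at-order : Saturated (a + b)
  saturated-at-order with saturated-or-large (a + b)
  ... | inj₁ (j , j≤n , sat) = saturated-mono j≤n sat
  ... | inj₂ n<size          = ⊥-elim (<⇒≱ n<size (size≤order (a + b)))

  reachable : Vtx a b → Bool
  reachable = level (a + b)

  reachable-source : reachable s ≡ true
  reachable-source = level-mono {0} {a + b} z≤n level-zero-source

  reachable-closed : ∀ {u v} → reachable u ≡ true → Ed u v ≡ true → reachable v ≡ true
  reachable-closed ru e = saturated-at-order _ (level-step (a + b) ru e)

  level⇒reachable : ∀ k {v} → level k v ≡ true → reachable v ≡ true
  level⇒reachable zero {v} lv = level-mono {0} {a + b} z≤n {v} lv
  level⇒reachable (suc k) lv with level-suc-inv k lv
  ... | inj₁ lkv          = level⇒reachable k lkv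
  ... | inj₂ (u , lu , e) = reachable-closed (level⇒reachable k lu) e

  reachable-ind : ∀ {ℓ} (Q : Vtx a b → Set ℓ) → Q s →
    (∀ {u v} → reachable u ≡ true → reachable v ≡ true → Ed u v ≡ true → Q u → Q v) →
    ∀ {v} → reachable v ≡ true → Q v
  reachable-ind Q Qs step = go (a + b)
    where
    go : ∀ k {v} → level k v ≡ true → Q v
    go zero {v} lv = subst Q (sym (level-zero-inv lv)) Qs
    go (suc k) lv with level-suc-inv k lv
    ... | inj₁ lkv          = go k lkv
    ... | inj₂ (u , lu , e) = step (level⇒reachable k lu) (level⇒reachable (suc k) lv) e (go k lu)

  Fresh : ℕ → Vtx a b → Set
  Fresh zero    v = ⊤
  Fresh (suc m) v = level m v ≡ false

  AtDistance : ℕ → Vtx a b → Set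
  AtDistance m v = level m v ≡ true × Fresh m v

  distance : ∀ k {v} → level k v ≡ true → ∃[ m ] AtDistance m v
  distance zero        lv = 0 , lv , tt
  distance (suc k) {v} lv = bool-cases (level k v) (distance k) (λ old → suc k , lv , old)

  not-fresh-later : ∀ {m m' v} → m < m' → level m v ≡ true → Fresh m' v → ⊥
  not-fresh-later (s≤s m≤m'') lm fm' = ≡true⇒≢false (level-mono m≤m'' lm) fm'

  distance-unique : ∀ {m m' v} → AtDistance m v → AtDistance m' v → m ≡ m'
  distance-unique {m} {m'} (lm , fm) (lm' , fm') with <-cmp m m'
  ... | tri≈ _ m≡m' _ = m≡m'
  ... | tri< m<m' _ _ = ⊥-elim (not-fresh-later m<m' lm fm')
  ... | tri> _ _ m'<m = ⊥-elim (not-fresh-later m'<m lm' fm)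

  record ShortestPath (m : ℕ) (v : Vtx a b) : Set where
    field
      vertex   : ℕ → Vtx a b
      starts   : vertex 0 ≡ s
      ends     : vertex m ≡ v
      layered  : ∀ i → i ≤ m → AtDistance i (vertex i)
      steps    : ∀ i → i < m → Ed (vertex i) (vertex (suc i)) ≡ true

  extend : (ℕ → Vtx a b) → ℕ → Vtx a b → ℕ → Vtx a b
  extend p n v i with i ≟ n
  ... | yes _ = v
  ... | no  _ = p i

  extend-at : ∀ p n v → extend p n v n ≡ v
  extend-at p n v with n ≟ n
  ... | yes _   = refl
  ... | no  n≢n = ⊥-elim (n≢n refl)

  extend-before : ∀ p {n} v {i} → i < n → extend p n v i ≡ p i
  extend-before p {n} v {i} i<n with i ≟ n
  ... | yes refl = ⊥-elim (<-irrefl refl i<n)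
  ... | no  _    = refl

  predecessor-fresh : ∀ m {u v} → Ed u v ≡ true → Fresh (suc m) v → Fresh m u
  predecessor-fresh zero    _ _  = tt
  predecessor-fresh (suc m) e fv =
    bool-cases (level m _) (λ lu → ⊥-elim (≡true⇒≢false (level-step m lu e) fv)) (λ old → old)

  shortest-path : ∀ m {v} → AtDistance m v → ShortestPath m v
  shortest-path zero {v} (lv , _) = record
    { vertex = λ _ → s ; starts = refl ; ends = sym (level-zero-inv lv)
    ; layered = λ { zero _ → level-zero-source , tt } ; steps = λ _ () }
  shortest-path (suc m) {v} (lv , fv) with level-suc-inv m lv
  ... | inj₁ lmv = ⊥-elim (≡true⇒≢false lmv fv)
  ... | inj₂ (u , lu , e) = record
    { vertex = extend vertex (suc m) v
    ; starts = trans (extend-before vertex {suc m} v (s≤s z≤n)) starts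
    ; ends = extend-at vertex (suc m) v
    ; layered = layered′
    ; steps = steps′ }
    where
    open ShortestPath (shortest-path m (lu , predecessor-fresh m e fv))
    layered′ : ∀ i → i ≤ suc m → AtDistance i (extend vertex (suc m) v i)
    layered′ i i≤1+m with m≤n⇒m<n∨m≡n i≤1+m
    ... | inj₂ refl = subst (AtDistance (suc m)) (sym (extend-at vertex (suc m) v)) (lv , fv)
    ... | inj₁ (s≤s i≤m) = subst (AtDistance i) (sym (extend-before vertex v (s≤s i≤m))) (layered i i≤m)
    steps′ : ∀ i → i < suc m → Ed (extend vertex (suc m) v i) (extend vertex (suc m) v (suc i)) ≡ true
    steps′ i (s≤s i≤m) with m≤n⇒m<n∨m≡n i≤m
    ... | inj₁ i<m = subst₂ (λ x y → Ed x y ≡ true) (sym (extend-before vertex v (s≤s i≤m)))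
                       (sym (extend-before vertex v (s≤s i<m))) (steps i i<m)
    ... | inj₂ refl = subst₂ (λ x y → Ed x y ≡ true) (sym (trans (extend-before vertex v ≤-refl) ends))
                       (sym (extend-at vertex (suc m) v)) e

  path-to : ∀ {t} → reachable t ≡ true → Path Ed s t
  path-to rt with distance (a + b) rt
  ... | m , dt = record
    { length = m ; vertex = vertex ; starts = starts ; ends = ends ; steps = steps
    ; simple = λ i i' i≤m i'≤m eq →
        distance-unique (layered i i≤m) (subst (AtDistance i') (sym eq) (layered i' i'≤m)) }
    where open ShortestPath (shortest-path m dt)

  reachable-origin : ∀ {v} → reachable v ≡ true → v ≡ s ⊎ ∃[ u ] (reachable u ≡ true × Ed u v ≡ true)
  reachable-origin = reachable-ind (λ v → v ≡ s ⊎ ∃[ u ] (reachable u ≡ true × Ed u v ≡ true))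
    (inj₁ refl) (λ {u} ru _ e _ → inj₂ (u , ru , e))

-- Alternating paths

alternating : ∀ {a b} {G : BipGraph a b} → PerfectMatching G → (Fin a → Bool) → Vtx a b → Vtx a b → Bool
alternating         P allowed (inj₁ i) (inj₂ j) = M P i j ∧ allowed i
alternating {G = G} P allowed (inj₂ j) (inj₁ i) = adj G i j ∧ not (M P i j)
alternating         P allowed (inj₁ _) (inj₁ _) = false
alternating         P allowed (inj₂ _) (inj₂ _) = false

module _ {a b} {G : BipGraph a b} (P : PerfectMatching G) (allowed : Fin a → Bool) where

  open Partner P

  data AlternatingStep (u v : Vtx a b) : Set where
    matching-step     : ∀ {i} → u ≡ inj₁ i → v ≡ inj₂ (mate i) → allowed i ≡ true → AlternatingStep u v
    non-matching-step : ∀ {i j} → u ≡ inj₂ j → v ≡ inj₁ i → adj G i j ≡ true → M P i j ≡ false →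
                        AlternatingStep u v

  alternating-step : ∀ {u v} → alternating P allowed u v ≡ true → AlternatingStep u v
  alternating-step {inj₁ i} {inj₂ j} e with ∧-true⇒× {M P i j} e
  ... | ij∈P , allowed-i = matching-step refl (cong inj₂ (sym (∈⇒mate ij∈P))) allowed-i
  alternating-step {inj₂ j} {inj₁ i} e with ∧-true⇒× {adj G i j} e
  ... | ij∈G , ij∉P = non-matching-step refl refl ij∈G (not≡true⇒≡false ij∉P)

  mate-alternating : ∀ {i} → allowed i ≡ true → alternating P allowed (inj₁ i) (inj₂ (mate i)) ≡ true
  mate-alternating allowed-i = ∧-true (mate-∈ _) allowed-i

  non-matching-alternating : ∀ {i j} → adj G i j ≡ true → M P i j ≡ false →
    alternating P allowed (inj₂ j) (inj₁ i) ≡ true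
  non-matching-alternating ij∈G ij∉P = ∧-true ij∈G (≡false⇒not≡true ij∉P)

module Switch {a b} {G : BipGraph a b} (P : PerfectMatching G) (allowed : Fin a → Bool) (i₀ : Fin a)
  (path : Path (alternating P allowed) (inj₂ (Partner.mate P i₀)) (inj₁ i₀)) where

  open Partner P
  open Path path

  on-path : Vtx a b → Bool
  on-path v = does (anyUpTo? (λ m → vertex m ≟V v) (suc length))

  on-path⇒ : ∀ {v} → on-path v ≡ true → ∃[ m ] (m ≤ length × vertex m ≡ v)
  on-path⇒ {v} on with does⇒ (anyUpTo? (λ m → vertex m ≟V v) (suc length)) on
  ... | m , s≤s m≤length , eq = m , m≤length , eq

  vertex-on-path : ∀ {m} → m ≤ length → on-path (vertex m) ≡ true
  vertex-on-path {m} m≤length =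
    dec-true (anyUpTo? (λ m' → vertex m' ≟V vertex m) (suc length)) (m , s≤s m≤length , refl)

  Step : Fin a → Fin b → ℕ → Set
  Step i j m = m < length × vertex m ≡ inj₂ j × vertex (suc m) ≡ inj₁ i

  step? : ∀ i j m → Dec (vertex m ≡ inj₂ j × vertex (suc m) ≡ inj₁ i)
  step? i j m = (vertex m ≟V inj₂ j) ×-dec (vertex (suc m) ≟V inj₁ i)

  traverses : Fin a → Fin b → Bool
  traverses i j = does (anyUpTo? (step? i j) length)

  traverses⇒ : ∀ {i j} → traverses i j ≡ true → ∃ (Step i j)
  traverses⇒ {i} {j} t with does⇒ (anyUpTo? (step? i j) length) t
  ... | m , m<length , eqs = m , m<length , eqs

  ⇒traverses : ∀ {i j m} → Step i j m → traverses i j ≡ true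
  ⇒traverses {i} {j} {m} (m<length , eqs) = dec-true (anyUpTo? (step? i j) length) (m , m<length , eqs)

  path-step : ∀ {m} → m < length → AlternatingStep P allowed (vertex m) (vertex (suc m))
  path-step m<length = alternating-step P allowed (steps _ m<length)

  end-on-path : on-path (inj₁ i₀) ≡ true
  end-on-path = subst (λ v → on-path v ≡ true) ends (vertex-on-path ≤-refl)

  start-on-path : on-path (inj₂ (mate i₀)) ≡ true
  start-on-path = subst (λ v → on-path v ≡ true) starts (vertex-on-path z≤n)

  predecessor-of-A : ∀ {m i} → m ≤ length → vertex m ≡ inj₁ i → ∃[ j ] traverses i j ≡ true
  predecessor-of-A {zero}  _        v₀≡i = ⊥-elim (inj₁≢inj₂ (trans (sym v₀≡i) starts))
  predecessor-of-A {suc m} m<length vm≡i with path-step m<length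
  ... | matching-step _ vm≡b _            = ⊥-elim (inj₁≢inj₂ (trans (sym vm≡i) vm≡b))
  ... | non-matching-step {j = j} u≡j _ _ _ = j , ⇒traverses (m<length , u≡j , vm≡i)

  on-path-B : ∀ {j} → on-path (inj₂ j) ≡ true →
    j ≡ mate i₀ ⊎ (allowed (mate⁻¹ j) ≡ true × on-path (inj₁ (mate⁻¹ j)) ≡ true)
  on-path-B on = predecessor (on-path⇒ on)
    where
    predecessor : ∀ {j} → ∃[ m ] (m ≤ length × vertex m ≡ inj₂ j) →
      j ≡ mate i₀ ⊎ (allowed (mate⁻¹ j) ≡ true × on-path (inj₁ (mate⁻¹ j)) ≡ true)
    predecessor (zero , _ , v₀≡j) = inj₁ (inj₂-injective (trans (sym v₀≡j) starts))
    predecessor (suc m , m<length , vm≡j) with path-step m<length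
    ... | non-matching-step _ v≡i _ _ = ⊥-elim (inj₁≢inj₂ (trans (sym v≡i) vm≡j))
    ... | matching-step {i} u≡i v≡mate allowed-i with inj₂-injective (trans (sym vm≡j) v≡mate)
    ... | refl = inj₂ (subst (λ x → allowed x ≡ true) (sym (mate⁻¹-mate i)) allowed-i ,
                       subst (λ x → on-path (inj₁ x) ≡ true) (sym (mate⁻¹-mate i))
                         (subst (λ v → on-path v ≡ true) u≡i (vertex-on-path (<⇒≤ m<length))))

  mate-off-path : ∀ {i} → on-path (inj₁ i) ≡ false → on-path (inj₂ (mate i)) ≡ false
  mate-off-path {i} off =
    bool-cases (on-path (inj₂ (mate i))) (λ on → ⊥-elim (absurd (on-path-B on))) (λ off′ → off′)
    where
    absurd : mate i ≡ mate i₀ ⊎ (allowed (mate⁻¹ (mate i)) ≡ true × on-path (inj₁ (mate⁻¹ (mate i))) ≡ true) → ⊥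
    absurd (inj₁ eq)       =
      ≡true⇒≢false (subst (λ x → on-path (inj₁ x) ≡ true) (sym (mate-injective eq)) end-on-path) off
    absurd (inj₂ (_ , on)) = ≡true⇒≢false (subst (λ x → on-path (inj₁ x) ≡ true) (mate⁻¹-mate i) on) off

  successor-of-A : ∀ {m i} → m < length → vertex m ≡ inj₁ i → vertex (suc m) ≡ inj₂ (mate i)
  successor-of-A m<length vm≡i with path-step m<length
  ... | matching-step u≡i v≡mate _ with inj₁-injective (trans (sym vm≡i) u≡i)
  ... | refl = v≡mate
  successor-of-A m<length vm≡i | non-matching-step u≡j _ _ _ = ⊥-elim (inj₁≢inj₂ (trans (sym vm≡i) u≡j))

  successor-of-B : ∀ {m j} → m ≤ length → vertex m ≡ inj₂ j → ∃[ i ] traverses i j ≡ true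
  successor-of-B {m} {j} m≤length vm≡j with m≤n⇒m<n∨m≡n m≤length
  ... | inj₂ refl = ⊥-elim (inj₁≢inj₂ (trans (sym ends) vm≡j))
  ... | inj₁ m<length with path-step m<length
  ...   | non-matching-step {i} _ v≡i _ _ = i , ⇒traverses (m<length , vm≡j , v≡i)
  ...   | matching-step u≡i _ _           = ⊥-elim (inj₁≢inj₂ (trans (sym u≡i) vm≡j))

  traverses-non-matching : ∀ {i j} → traverses i j ≡ true → adj G i j ≡ true × M P i j ≡ false
  traverses-non-matching t with traverses⇒ t
  ... | m , m<length , vm≡j , vsm≡i with path-step m<length
  ...   | matching-step u≡i _ _ = ⊥-elim (inj₁≢inj₂ (trans (sym u≡i) vm≡j))
  ...   | non-matching-step u≡j v≡i ij∈G ij∉P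
          with inj₂-injective (trans (sym vm≡j) u≡j) | inj₁-injective (trans (sym vsm≡i) v≡i)
  ...     | refl | refl = ij∈G , ij∉P

  traverses-on-path : ∀ {i j} → traverses i j ≡ true → on-path (inj₂ j) ≡ true
  traverses-on-path t with traverses⇒ t
  ... | m , m<length , vm≡j , _ = subst (λ v → on-path v ≡ true) vm≡j (vertex-on-path (<⇒≤ m<length))

  traverses-mate-on-path : ∀ {i j j'} → traverses i j ≡ true → M P i j' ≡ true → on-path (inj₂ j') ≡ true
  traverses-mate-on-path {i} t ij'∈P =
    subst (λ x → on-path (inj₂ x) ≡ true) (∈⇒mate ij'∈P) (mate-on-path (traverses⇒ t))
    where
    mate-on-path : ∃ (Step i _) → on-path (inj₂ (mate i)) ≡ true
    mate-on-path (m , m<length , _ , vsm≡i) with m≤n⇒m<n∨m≡n m<length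
    ... | inj₁ sm<length = subst (λ v → on-path v ≡ true) (successor-of-A sm<length vsm≡i) (vertex-on-path sm<length)
    ... | inj₂ refl with inj₁-injective (trans (sym vsm≡i) ends)
    ...   | refl = start-on-path

  traverses-unique-A : ∀ {i j j'} → traverses i j ≡ true → traverses i j' ≡ true → j ≡ j'
  traverses-unique-A t t' with traverses⇒ t | traverses⇒ t'
  ... | m , m<length , vm≡j , vsm≡i | m' , m'<length , vm'≡j' , vsm'≡i
        with simple (suc m) (suc m') m<length m'<length (trans vsm≡i (sym vsm'≡i))
  ...   | refl = inj₂-injective (trans (sym vm≡j) vm'≡j')

  traverses-unique-B : ∀ {i i' j} → traverses i j ≡ true → traverses i' j ≡ true → i ≡ i'
  traverses-unique-B t t' with traverses⇒ t | traverses⇒ t'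
  ... | m , m<length , vm≡j , vsm≡i | m' , m'<length , vm'≡j , vsm'≡i'
        with simple m m' (<⇒≤ m<length) (<⇒≤ m'<length) (trans vm≡j (sym vm'≡j))
  ...   | refl = inj₁-injective (trans (sym vsm≡i) vsm'≡i')

  -- P switched along the alternating cycle formed by the path and the edge (i₀ , mate i₀).
  switched : Fin a → Fin b → Bool
  switched i j = traverses i j ∨ (not (on-path (inj₂ j)) ∧ M P i j)

  switched-cases : ∀ {i j} → switched i j ≡ true →
    traverses i j ≡ true ⊎ (on-path (inj₂ j) ≡ false × M P i j ≡ true)
  switched-cases {i} {j} s with ∨-true⇒⊎ {traverses i j} s
  ... | inj₁ t    = inj₁ t
  ... | inj₂ kept = inj₂ (not≡true⇒≡false (proj₁ (∧-true⇒× kept)) , proj₂ (∧-true⇒× kept))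

  switched-keeps : ∀ {i j} → M P i j ≡ true → on-path (inj₂ j) ≡ false → switched i j ≡ true
  switched-keeps {i} {j} ij∈P off = ∨-trueʳ {traverses i j} (∧-true (≡false⇒not≡true off) ij∈P)

  switched-cover-A : ∀ i → ∃[ j ] switched i j ≡ true
  switched-cover-A i = bool-cases (on-path (inj₁ i))
    (λ on → let m , m≤length , vm≡i = on-path⇒ on
                j , t               = predecessor-of-A m≤length vm≡i
            in j , ∨-trueˡ t)
    (λ off → mate i , switched-keeps (mate-∈ i) (mate-off-path off))

  switched-cover-B : ∀ j → ∃[ i ] switched i j ≡ true
  switched-cover-B j = bool-cases (on-path (inj₂ j))
    (λ on → let m , m≤length , vm≡j = on-path⇒ on
                i , t               = successor-of-B m≤length vm≡j
            in i , ∨-trueˡ t)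
    (λ off → mate⁻¹ j , switched-keeps (mate⁻¹-∈ j) off)

  switched-unique-A : ∀ i j j' → switched i j ≡ true → switched i j' ≡ true → j ≡ j'
  switched-unique-A i j j' s s' with switched-cases s | switched-cases s'
  ... | inj₁ t           | inj₁ t'           = traverses-unique-A t t'
  ... | inj₁ t            | inj₂ (off' , ij'∈P) = ⊥-elim (≡true⇒≢false (traverses-mate-on-path t ij'∈P) off')
  ... | inj₂ (off , ij∈P) | inj₁ t'            = ⊥-elim (≡true⇒≢false (traverses-mate-on-path t' ij∈P) off)
  ... | inj₂ (_ , ij∈P)  | inj₂ (_ , ij'∈P)  = uniqA P i j j' ij∈P ij'∈P

  switched-unique-B : ∀ j i i' → switched i j ≡ true → switched i' j ≡ true → i ≡ i'
  switched-unique-B j i i' s s' with switched-cases s | switched-cases s'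
  ... | inj₁ t           | inj₁ t'           = traverses-unique-B t t'
  ... | inj₁ t           | inj₂ (off , _)    = ⊥-elim (≡true⇒≢false (traverses-on-path t) off)
  ... | inj₂ (off , _)   | inj₁ t'           = ⊥-elim (≡true⇒≢false (traverses-on-path t') off)
  ... | inj₂ (_ , ij∈P)  | inj₂ (_ , i'j∈P)  = uniqB P j i i' ij∈P i'j∈P

  switched-⊆G : ∀ i j → switched i j ≡ true → adj G i j ≡ true
  switched-⊆G i j s with switched-cases s
  ... | inj₁ t          = proj₁ (traverses-non-matching t)
  ... | inj₂ (_ , ij∈P) = sub P i j ij∈P

  switched-matching : PerfectMatching G
  switched-matching = record
    { M = switched ; sub = switched-⊆G
    ; coverA = switched-cover-A ; uniqA = switched-unique-A
    ; coverB = switched-cover-B ; uniqB = switched-unique-B }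

  switched-avoids : switched i₀ (mate i₀) ≡ false
  switched-avoids = bool-cases (switched i₀ (mate i₀)) (λ s → ⊥-elim (absurd (switched-cases s))) (λ s → s)
    where
    absurd : traverses i₀ (mate i₀) ≡ true ⊎ (on-path (inj₂ (mate i₀)) ≡ false × M P i₀ (mate i₀) ≡ true) →
      ⊥
    absurd (inj₁ t)       = ≡true⇒≢false (mate-∈ i₀) (proj₂ (traverses-non-matching t))
    absurd (inj₂ (off , _)) = ≡true⇒≢false start-on-path off

-- The cut determined by an equivalent pair

matching-avoiding : ∀ {a b} (G : BipGraph a b) → Connected G →
  (∀ e → e ∈E G → Σ (PerfectMatching G) λ Q → e ∈M Q) →
  ∀ {i₁ i₂} j₁ → i₁ ≢ i₂ → Σ (PerfectMatching G) λ Q → M Q i₁ j₁ ≡ false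
matching-avoiding {a} {b} G connected covered {i₁} {i₂} j₁ i₁≢i₂
  with reach-crossing S (proj₂ connected (inj₁ i₁) (inj₁ i₂) refl refl)
         (dec-true (i₁ ≟F i₁) refl) (dec-false (i₂ ≟F i₁) (i₁≢i₂ ∘ sym))
  where
  S : Vtx a b → Bool
  S (inj₁ i) = does (i ≟F i₁)
  S (inj₂ j) = does (j ≟F j₁)
... | i , j , ij∈G , crosses with covered (i , j) ij∈G
... | Q , ij∈Q with i ≟F i₁ | j ≟F j₁
... | yes refl | yes refl = ⊥-elim (crosses refl)
... | no  _    | no  _    = ⊥-elim (crosses refl)
... | yes refl | no  j≢j₁ =
  Q , bool-cases (M Q i₁ j₁) (λ i₁j₁∈Q → ⊥-elim (j≢j₁ (uniqA Q i₁ j j₁ ij∈Q i₁j₁∈Q))) (λ ∉ → ∉)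
... | no  i≢i₁ | yes refl =
  Q , bool-cases (M Q i₁ j₁) (λ i₁j₁∈Q → ⊥-elim (i≢i₁ (uniqB Q j₁ i i₁ ij∈Q i₁j₁∈Q))) (λ ∉ → ∉)

module EquivalentMatchingEdges {a b} (G : BipGraph a b) (connected : Connected G)
  (covered : ∀ e → e ∈E G → Σ (PerfectMatching G) λ Q → e ∈M Q)
  (P : PerfectMatching G) {a₁ a₂ : Fin a} (a₁≢a₂ : a₁ ≢ a₂)
  (e~f : Equivalent G (a₁ , Partner.mate P a₁) (a₂ , Partner.mate P a₂)) where

  open Partner P

  b₁ b₂ : Fin b
  b₁ = mate a₁
  b₂ = mate a₂

  -- Matching arcs out of a₁ and a₂ are removed, so that no alternating path uses e or f.
  allowed : Fin a → Bool
  allowed i = not (does (i ≟F a₁)) ∧ not (does (i ≟F a₂))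

  allowed⇒≢ : ∀ {i} → allowed i ≡ true → i ≢ a₁ × i ≢ a₂
  allowed⇒≢ {i} al with i ≟F a₁ | i ≟F a₂ | al
  ... | no i≢a₁ | no i≢a₂ | _ = i≢a₁ , i≢a₂

  ≢⇒allowed : ∀ {i} → i ≢ a₁ → i ≢ a₂ → allowed i ≡ true
  ≢⇒allowed {i} i≢a₁ i≢a₂ =
    ∧-true (≡false⇒not≡true (dec-false (i ≟F a₁) i≢a₁)) (≡false⇒not≡true (dec-false (i ≟F a₂) i≢a₂))

  open Closure (alternating P allowed) (inj₂ b₁) public

  RA : Fin a → Bool
  RA = reachable ∘ inj₁

  RB : Fin b → Bool
  RB = reachable ∘ inj₂

  b₂≢b₁ : b₂ ≢ b₁
  b₂≢b₁ eq = a₁≢a₂ (mate-injective (sym eq))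

  mate⁻¹b₂-disallowed : allowed (mate⁻¹ b₂) ≢ true
  mate⁻¹b₂-disallowed al = proj₂ (allowed⇒≢ al) (mate⁻¹-mate a₂)

  a₁-unreachable : RA a₁ ≡ false
  a₁-unreachable = bool-cases (RA a₁) (λ r → ⊥-elim (switch-absurd (path-to r))) (λ u → u)
    where
    switch-absurd : Path (alternating P allowed) (inj₂ b₁) (inj₁ a₁) → ⊥
    switch-absurd path = ≡true⇒≢false (proj₂ (e~f switched-matching) f∈Q) switched-avoids
      where
      open Switch P allowed a₁ path
      b₂-off-path : on-path (inj₂ b₂) ≡ false
      b₂-off-path = bool-cases (on-path (inj₂ b₂))
        (λ on → ⊥-elim ([ b₂≢b₁ , mate⁻¹b₂-disallowed ∘ proj₁ ] (on-path-B on))) (λ off → off)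
      f∈Q : switched a₂ b₂ ≡ true
      f∈Q = switched-keeps (mate-∈ a₂) b₂-off-path

  reachable-B : ∀ {j} → RB j ≡ true → j ≡ b₁ ⊎ (allowed (mate⁻¹ j) ≡ true × RA (mate⁻¹ j) ≡ true)
  reachable-B {j} rj with reachable-origin {inj₂ j} rj
  ... | inj₁ eq = inj₁ (inj₂-injective eq)
  ... | inj₂ (u , ru , e) with alternating-step P allowed {u} {inj₂ j} e
  ...   | non-matching-step _ v≡i _ _ = ⊥-elim (inj₁≢inj₂ (sym v≡i))
  ...   | matching-step {i} u≡i v≡mate al with inj₂-injective v≡mate
  ...     | refl = inj₂ (subst (λ x → allowed x ≡ true) (sym (mate⁻¹-mate i)) al ,
                         subst (λ x → RA x ≡ true) (sym (mate⁻¹-mate i)) (subst (λ v → reachable v ≡ true) u≡i ru))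

  b₂-unreachable : RB b₂ ≡ false
  b₂-unreachable = bool-cases (RB b₂)
    (λ r → ⊥-elim ([ b₂≢b₁ , mate⁻¹b₂-disallowed ∘ proj₁ ] (reachable-B r))) (λ u → u)

  mate-reachable : ∀ {i} → i ≢ a₂ → RA i ≡ true → RB (mate i) ≡ true
  mate-reachable {i} i≢a₂ ri = reachable-closed ri (mate-alternating P allowed (≢⇒allowed i≢a₁ i≢a₂))
    where
    i≢a₁ : i ≢ a₁
    i≢a₁ refl = ≡true⇒≢false ri a₁-unreachable

  mate⁻¹-reachable : ∀ {j} → j ≢ b₁ → RB j ≡ true → RA (mate⁻¹ j) ≡ true
  mate⁻¹-reachable j≢b₁ rj = [ ⊥-elim ∘ j≢b₁ , proj₂ ] (reachable-B rj)

  reachable-matched : ∀ i → i ≢ a₁ → i ≢ a₂ → RA i ≡ RB (mate i)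
  reachable-matched i i≢a₁ i≢a₂ = bool-cases (RB (mate i))
    (λ rmi → trans (subst (λ x → RA x ≡ true) (mate⁻¹-mate i) (mate⁻¹-reachable (i≢a₁ ∘ mate-injective) rmi))
                   (sym rmi))
    (λ rmi → trans (bool-cases (RA i) (λ ri → ⊥-elim (≡true⇒≢false (mate-reachable i≢a₂ ri) rmi)) (λ ri → ri))
                   (sym rmi))

  matched-into-reachable : (Q : PerfectMatching G) → ∀ {j} → RB j ≡ true → (j ≡ b₁ → M Q a₁ b₁ ≡ false) →
    RA (Partner.mate⁻¹ Q j) ≡ true
  matched-into-reachable Q {j} rj e∉Q = bool-cases (M P (Q.mate⁻¹ j) j) in-P not-in-P
    where
    module Q = Partner Q
    in-P : M P (Q.mate⁻¹ j) j ≡ true → RA (Q.mate⁻¹ j) ≡ true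
    in-P ij∈P with reachable-B rj
    ... | inj₁ refl = ⊥-elim (≡true⇒≢false
          (subst (λ x → M Q x b₁ ≡ true) (uniqB P b₁ _ a₁ ij∈P (mate-∈ a₁)) (Q.mate⁻¹-∈ b₁)) (e∉Q refl))
    ... | inj₂ (_ , r) = subst (λ x → RA x ≡ true) (∈⇒mate⁻¹ ij∈P) r
    not-in-P : M P (Q.mate⁻¹ j) j ≡ false → RA (Q.mate⁻¹ j) ≡ true
    not-in-P ij∉P = reachable-closed rj (non-matching-alternating P allowed (sub Q _ j (Q.mate⁻¹-∈ j)) ij∉P)

  matched-into-reachable-≤ : (Q : PerfectMatching G) → M Q a₁ b₁ ≡ false → countTrue RB ≤ countTrue RA
  matched-into-reachable-≤ Q e∉Q = countTrue-injection-≤ RB RA (Partner.mate⁻¹ Q) (Partner.mate⁻¹-injective Q)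
    (λ j rj → matched-into-reachable Q rj (λ _ → e∉Q))

  -- Otherwise P maps the reachable A-vertices into the reachable B-vertices other than b₁,
  -- while a matching avoiding e maps the reachable B-vertices injectively back.
  a₂-reachable : RA a₂ ≡ true
  a₂-reachable = bool-cases (RA a₂) (λ r → r) λ a₂-unreachable → ⊥-elim (<⇒≱
    (countTrue-injection-< RA RB mate mate-injective
      (λ i ri → mate-reachable (λ { refl → ≡true⇒≢false ri a₂-unreachable }) ri)
      b₁ reachable-source
      (λ i ri mi≡b₁ → ≡true⇒≢false ri (subst (λ x → RA x ≡ false) (sym (mate-injective mi≡b₁)) a₁-unreachable)))
    (matched-into-reachable-≤ Q₀ Q₀-avoids-e))
    where
    open Σ (matching-avoiding G connected covered b₁ a₁≢a₂) renaming (proj₁ to Q₀; proj₂ to Q₀-avoids-e)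

  reachable-balanced : Balanced reachable
  reachable-balanced = balanced-if-crossed-oppositely P reachable a₁ a₂ a₁≢a₂
    a₁-unreachable reachable-source a₂-reachable b₂-unreachable reachable-matched

  module _ (Q : PerfectMatching G) {i : Fin a} (ri : RA i ≡ true) (unr : RB (Partner.mate Q i) ≡ false) where

    private module Q = Partner Q

    mate⁻¹-misses : ∀ {j} → RB j ≡ true → Q.mate⁻¹ j ≢ i
    mate⁻¹-misses {j} rj eq =
      ≡true⇒≢false (subst (λ x → RB x ≡ true) (trans (sym (Q.mate-mate⁻¹ j)) (cong Q.mate eq)) rj) unr

    unreachable-mate-avoiding-e-absurd : M Q a₁ b₁ ≡ false → ⊥
    unreachable-mate-avoiding-e-absurd e∉Q = <⇒≱
      (countTrue-injection-< RB RA Q.mate⁻¹ Q.mate⁻¹-injective (λ j rj → matched-into-reachable Q rj (λ _ → e∉Q))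
        i ri (λ j rj → mate⁻¹-misses rj))
      (≤-reflexive reachable-balanced)

    -- With e, hence f, in Q, Q.mate⁻¹ maps the reachable B-vertices other than b₁ into the reachable
    -- A-vertices other than a₂, missing i.
    unreachable-mate-containing-e-absurd : M Q a₁ b₁ ≡ true → (i , Q.mate i) ≢ (a₂ , b₂) → ⊥
    unreachable-mate-containing-e-absurd e∈Q ≢f = <⇒≱
      (countTrue-injection-< (remove RB b₁) (remove RA a₂) Q.mate⁻¹ Q.mate⁻¹-injective maps-into
        i (trans (remove-≢ RA i≢a₂) ri) (λ j rj → mate⁻¹-misses (remove-⊆ RB b₁ rj)))
      (≤-reflexive (ℕ.suc-injective (begin
        suc (countTrue (remove RA a₂)) ≡⟨ countTrue-remove RA a₂ a₂-reachable ⟨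
        countTrue RA                   ≡⟨ reachable-balanced ⟩
        countTrue RB                   ≡⟨ countTrue-remove RB b₁ reachable-source ⟩
        suc (countTrue (remove RB b₁)) ∎)))
      where
      open ≡-Reasoning
      f∈Q : M Q a₂ b₂ ≡ true
      f∈Q = proj₁ (e~f Q) e∈Q
      i≢a₂ : i ≢ a₂
      i≢a₂ refl = ≢f (cong (a₂ ,_) (Q.∈⇒mate f∈Q))
      maps-into : ∀ j → remove RB b₁ j ≡ true → remove RA a₂ (Q.mate⁻¹ j) ≡ true
      maps-into j rj = trans (remove-≢ RA mate⁻¹j≢a₂)
        (matched-into-reachable Q (remove-⊆ RB b₁ rj) (⊥-elim ∘ remove-true⇒≢ RB b₁ rj))
        where
        mate⁻¹j≢a₂ : Q.mate⁻¹ j ≢ a₂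
        mate⁻¹j≢a₂ eq = ≡true⇒≢false (remove-⊆ RB b₁ rj)
          (subst (λ x → RB x ≡ false) (trans (sym (Q.∈⇒mate f∈Q)) (trans (cong Q.mate (sym eq)) (Q.mate-mate⁻¹ j)))
            b₂-unreachable)

  matching-preserves-reachable : (Q : PerfectMatching G) → ∀ {i} → (i , Partner.mate Q i) ≢ (a₂ , b₂) →
    RA i ≡ true → RB (Partner.mate Q i) ≡ true
  matching-preserves-reachable Q {i} ≢f ri = bool-cases (RB (Partner.mate Q i)) (λ r → r) λ unr →
    ⊥-elim (bool-cases (M Q a₁ b₁)
      (λ e∈Q → unreachable-mate-containing-e-absurd Q ri unr e∈Q ≢f)
      (unreachable-mate-avoiding-e-absurd Q ri unr))

  Cut : EdgeRel a b
  Cut = removeEdges G (a₁ , b₁) (a₂ , b₂)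

  reachable-flat : ∀ i j → Cut i j → RA i ≡ RB j
  reachable-flat i j (ij∈G , ≢e , ≢f) = bool-cases (RA i)
    (λ ri → trans ri (sym (subst (λ x → RB x ≡ true) (Q.∈⇒mate ij∈Q)
                            (matching-preserves-reachable Q (≢f ∘ subst (λ x → (i , x) ≡ (a₂ , b₂)) (Q.∈⇒mate ij∈Q)) ri))))
    (λ ri → trans ri (sym (bool-cases (RB j) (λ rj → ⊥-elim (≡true⇒≢false (backward rj) ri)) (λ rj → rj))))
    where
    open Σ (covered (i , j) ij∈G) renaming (proj₁ to Q; proj₂ to ij∈Q)
    module Q = Partner Q
    backward : RB j ≡ true → RA i ≡ true
    backward rj = bool-cases (M P i j)
      (λ ij∈P → subst (λ x → RA x ≡ true) (∈⇒mate⁻¹ ij∈P)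
                  (mate⁻¹-reachable (λ { refl → ≢e (cong (_, b₁) (uniqB P b₁ i a₁ ij∈P (mate-∈ a₁))) }) rj))
      (λ ij∉P → reachable-closed rj (non-matching-alternating P allowed ij∈G ij∉P))

  reach-from-source : ∀ {v} → reachable v ≡ true → Reach Cut reachable (inj₂ b₁) v
  reach-from-source = reachable-ind (Reach Cut reachable (inj₂ b₁)) (here reachable-source) step
    where
    step : ∀ {u v} → reachable u ≡ true → reachable v ≡ true → alternating P allowed u v ≡ true →
      Reach Cut reachable (inj₂ b₁) u → Reach Cut reachable (inj₂ b₁) v
    step {u} {v} _ rv e r with alternating-step P allowed {u} {v} e
    ... | matching-step {i} refl refl al =
      stepAB r (sub P i (mate i) (mate-∈ i) , proj₁ (allowed⇒≢ al) ∘ cong proj₁ , proj₂ (allowed⇒≢ al) ∘ cong proj₁)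
        rv
    ... | non-matching-step refl refl ij∈G ij∉P =
      stepBA r (ij∈G , (λ { refl → ≡true⇒≢false (mate-∈ a₁) ij∉P }) , (λ { refl → ≡true⇒≢false (mate-∈ a₂) ij∉P }))
        rv

  reachable-connected : ConnectedOn Cut reachable
  reachable-connected = (inj₂ b₁ , reachable-source) ,
    λ u v ru rv → reach-trans (reach-sym (reach-from-source ru)) (reach-from-source rv)

-- Transposition

transpose : ∀ {a b} → BipGraph a b → BipGraph b a
transpose G = record { adj = flip (adj G) }

module _ {a b} {G : BipGraph a b} where

  transpose-matching : PerfectMatching G → PerfectMatching (transpose G)
  transpose-matching Q = record
    { M = flip (M Q) ; sub = flip (sub Q)
    ; coverA = coverB Q ; uniqA = uniqB Q ; coverB = coverA Q ; uniqB = uniqA Q }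

  untranspose-matching : PerfectMatching (transpose G) → PerfectMatching G
  untranspose-matching Q = record
    { M = flip (M Q) ; sub = flip (sub Q)
    ; coverA = coverB Q ; uniqA = uniqB Q ; coverB = coverA Q ; uniqB = uniqA Q }

  transpose-equivalent : ∀ {i₁ j₁ i₂ j₂} → Equivalent G (i₁ , j₁) (i₂ , j₂) →
    Equivalent (transpose G) (j₁ , i₁) (j₂ , i₂)
  transpose-equivalent e~f Q = e~f (untranspose-matching Q)

  transpose-covered : (∀ e → e ∈E G → Σ (PerfectMatching G) λ Q → e ∈M Q) →
    ∀ e → e ∈E transpose G → Σ (PerfectMatching (transpose G)) λ Q → e ∈M Q
  transpose-covered covered (j , i) ij∈G = transpose-matching (proj₁ (covered (i , j) ij∈G)) , proj₂ (covered (i , j) ij∈G)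

reach-transpose : ∀ {a b} {E : EdgeRel a b} {X : Vtx a b → Bool} {u v} →
  Reach E X u v → Reach (flip E) (X ∘ swap) (swap u) (swap v)
reach-transpose {X = X} {u = u} (here Xu) = here (subst (λ w → X w ≡ true) (sym (swap-involutive u)) Xu)
reach-transpose (stepAB r e Xv) = stepBA (reach-transpose r) e Xv
reach-transpose (stepBA r e Xv) = stepAB (reach-transpose r) e Xv

transpose-connected : ∀ {a b} {G : BipGraph a b} → Connected G → Connected (transpose G)
transpose-connected ((v , _) , connected) = (swap v , refl) , λ u w _ _ →
  subst₂ (Reach _ allV) (swap-involutive u) (swap-involutive w) (reach-transpose (connected (swap u) (swap w) refl refl))

-- The other side of the cut

Complementary : ∀ {a b} → (Vtx a b → Bool) → (Vtx a b → Bool) → Vtx a b → Set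
Complementary X Y v = Y v ≡ notB (X v)

module _ {a b} (G : BipGraph a b) (connected : Connected G) {e₁ e₂ : Edge a b} (X Y : Vtx a b → Bool)
  (X-flat : ∀ i j → removeEdges G e₁ e₂ i j → X (inj₁ i) ≡ X (inj₂ j))
  (Y-flat : ∀ i j → removeEdges G e₁ e₂ i j → Y (inj₁ i) ≡ Y (inj₂ j)) where

  complementary-everywhere :
    (∀ {e} → EdgePair e₁ e₂ e → Complementary X Y (inj₁ (proj₁ e)) × Complementary X Y (inj₂ (proj₂ e))) →
    ∀ v → Complementary X Y v
  complementary-everywhere at-cut v = go (proj₂ connected (inj₁ (proj₁ e₁)) v refl refl)
    where
    go : ∀ {v} → Reach (edgesOf G) allV (inj₁ (proj₁ e₁)) v → Complementary X Y v
    go (here _) = proj₁ (at-cut (inj₁ refl))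
    go (stepAB {i} {j} r ij∈G _) with (i , j) ≟E e₁ | (i , j) ≟E e₂
    ... | yes refl | _        = proj₂ (at-cut (inj₁ refl))
    ... | no _     | yes refl = proj₂ (at-cut (inj₂ refl))
    ... | no ≢e₁   | no ≢e₂   = trans (sym (Y-flat i j (ij∈G , ≢e₁ , ≢e₂)))
                                  (trans (go r) (cong notB (X-flat i j (ij∈G , ≢e₁ , ≢e₂))))
    go (stepBA {i} {j} r ij∈G _) with (i , j) ≟E e₁ | (i , j) ≟E e₂
    ... | yes refl | _        = proj₁ (at-cut (inj₁ refl))
    ... | no _     | yes refl = proj₁ (at-cut (inj₂ refl))
    ... | no ≢e₁   | no ≢e₂   = trans (Y-flat i j (ij∈G , ≢e₁ , ≢e₂))
                                  (trans (go r) (cong notB (sym (X-flat i j (ij∈G , ≢e₁ , ≢e₂)))))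

module OtherSide {a b} (G : BipGraph a b) (connected : Connected G)
  (covered : ∀ e → e ∈E G → Σ (PerfectMatching G) λ Q → e ∈M Q)
  (P : PerfectMatching G) {a₁ a₂ : Fin a} (a₁≢a₂ : a₁ ≢ a₂)
  (e~f : Equivalent G (a₁ , Partner.mate P a₁) (a₂ , Partner.mate P a₂)) where

  open Partner P
  open EquivalentMatchingEdges G connected covered P a₁≢a₂ e~f

  module T = EquivalentMatchingEdges (transpose G) (transpose-connected connected) (transpose-covered covered)
    (transpose-matching P) (b₂≢b₁ ∘ sym)
    (subst₂ (λ x y → Equivalent (transpose G) (b₁ , x) (b₂ , y)) (sym (mate⁻¹-mate a₁)) (sym (mate⁻¹-mate a₂))
      (transpose-equivalent e~f))

  Y : Vtx a b → Bool
  Y = T.reachable ∘ swap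

  cut⇒transposed-cut : ∀ {i j} → Cut i j → T.Cut j i
  cut⇒transposed-cut (ij∈G , ≢e , ≢f) =
    ij∈G , (λ { refl → ≢e (cong (_, b₁) (mate⁻¹-mate a₁)) }) ,
           (λ { refl → ≢f (cong (_, b₂) (mate⁻¹-mate a₂)) })

  transposed-cut⇒cut : ∀ {i j} → T.Cut j i → Cut i j
  transposed-cut⇒cut (ij∈G , ≢e , ≢f) =
    ij∈G , (λ { refl → ≢e (cong (b₁ ,_) (sym (mate⁻¹-mate a₁))) }) ,
           (λ { refl → ≢f (cong (b₂ ,_) (sym (mate⁻¹-mate a₂))) })

  Y-flat : ∀ i j → Cut i j → Y (inj₁ i) ≡ Y (inj₂ j)
  Y-flat i j cut = sym (T.reachable-flat j i (cut⇒transposed-cut cut))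

  at-cut : ∀ {e} → EdgePair (a₁ , b₁) (a₂ , b₂) e →
    Complementary reachable Y (inj₁ (proj₁ e)) × Complementary reachable Y (inj₂ (proj₂ e))
  at-cut (inj₁ refl) =
    trans (subst (λ x → T.RB x ≡ true) (mate⁻¹-mate a₁) T.reachable-source) (cong notB (sym a₁-unreachable)) ,
    trans T.a₁-unreachable (cong notB (sym reachable-source))
  at-cut (inj₂ refl) =
    trans (subst (λ x → T.RB x ≡ false) (mate⁻¹-mate a₂) T.b₂-unreachable) (cong notB (sym a₂-reachable)) ,
    trans T.a₂-reachable (cong notB (sym b₂-unreachable))

  complementary : ∀ v → Y v ≡ notB (reachable v)
  complementary = complementary-everywhere G connected reachable Y reachable-flat Y-flat at-cut

  complement-connected : ConnectedOn Cut (notB ∘ reachable)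
  complement-connected =
    (swap w , trans (sym (complementary (swap w))) (subst (λ x → T.reachable x ≡ true) (sym (swap-involutive w)) Tw)) ,
    λ u v Xᶜu Xᶜv → reach-map (λ i j → transposed-cut⇒cut) (λ z Yz → trans (sym (complementary z)) Yz)
      (subst₂ (Reach _ _) (swap-involutive u) (swap-involutive v)
        (reach-transpose (proj₂ T.reachable-connected (swap u) (swap v)
          (trans (complementary u) Xᶜu) (trans (complementary v) Xᶜv))))
    where
    open Σ (proj₁ T.reachable-connected) renaming (proj₁ to w; proj₂ to Tw)

  complement-balanced : Balanced (notB ∘ reachable)
  complement-balanced = begin
    countTrue (notB ∘ reachable ∘ inj₁) ≡⟨ countTrue-cong (sym ∘ complementary ∘ inj₁) ⟩
    countTrue (Y ∘ inj₁)                ≡⟨ T.reachable-balanced ⟨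
    countTrue (Y ∘ inj₂)                ≡⟨ countTrue-cong (complementary ∘ inj₂) ⟩
    countTrue (notB ∘ reachable ∘ inj₂) ∎
    where open ≡-Reasoning

equivalent-matching-edges⇒twoEdgeCut : ∀ {a b} (G : BipGraph a b) → Connected G →
  (∀ e → e ∈E G → Σ (PerfectMatching G) λ Q → e ∈M Q) →
  (P : PerfectMatching G) → ∀ {a₁ a₂} → a₁ ≢ a₂ →
  Equivalent G (a₁ , Partner.mate P a₁) (a₂ , Partner.mate P a₂) → TwoEdgeCutBalanced G
equivalent-matching-edges⇒twoEdgeCut G connected covered P {a₁} {a₂} a₁≢a₂ e~f =
  (a₁ , b₁) , (a₂ , b₂) , reachable , sub P a₁ b₁ (mate-∈ a₁) , sub P a₂ b₂ (mate-∈ a₂) , a₁≢a₂ ∘ cong proj₁ ,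
  reachable-connected , complement-connected , reachable-flat , reachable-balanced , complement-balanced
  where
  open Partner P
  open EquivalentMatchingEdges G connected covered P a₁≢a₂ e~f
  open OtherSide G connected covered P a₁≢a₂ e~f

equivalentClass⇒twoEdgeCut : ∀ {a b} (G : BipGraph a b) → MatchingCovered G →
  HasEquivalentClass G → TwoEdgeCutBalanced G
equivalentClass⇒twoEdgeCut G (connected , _ , covered)
  (K , K⊆G , ((i₁ , j₁) , (i₂ , j₂) , Ke , Kf , e≢f) , K-equivalent) =
  equivalent-matching-edges⇒twoEdgeCut G connected covered P i₁≢i₂
    (subst₂ (λ x y → Equivalent G (i₁ , x) (i₂ , y)) (sym (∈⇒mate e∈P)) (sym (∈⇒mate f∈P)) e~f)
  where
  e~f : Equivalent G (i₁ , j₁) (i₂ , j₂)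
  e~f = K-equivalent _ _ Ke Kf
  open Σ (covered (i₁ , j₁) (K⊆G _ Ke)) renaming (proj₁ to P; proj₂ to e∈P)
  open Partner P
  f∈P : M P i₂ j₂ ≡ true
  f∈P = proj₁ (e~f P) e∈P
  i₁≢i₂ : i₁ ≢ i₂
  i₁≢i₂ refl = e≢f (cong (i₁ ,_) (uniqA P i₁ j₁ j₂ e∈P f∈P))

theorem1p6 : ∀ {a b : ℕ} (G : BipGraph a b) → MatchingCovered G →
    (HasEquivalentClass G → TwoEdgeCutBalanced G) × (TwoEdgeCutBalanced G → HasEquivalentClass G)
theorem1p6 G mc = equivalentClass⇒twoEdgeCut G mc , twoEdgeCut⇒equivalentClass G mc
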